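{- Let $B>0$ and positive costs $c_1,\dots,c_n$, and set $k_i=\lfloor B/c_i\rfloor$ and $d(S)=\sum_{i\in S}1/k_i$. For any $S\subseteq[n]$ satisfying $c(S)=\sum_{i\in S}c_i\le B$, we have $d(S)\le1.7$.
   Formalization: The number B and the costs c_1,…,c_n are positive rationals. -}

module Defs where

open import Data.Nat using (ℕ; suc)
open import Data.Integer using (ℤ; +_; +[1+_]; -[1+_])
open import Data.Rational using (ℚ; 0ℚ; _+_; _÷_; _/_; floor; Positive)
open import Data.Rational.Properties using (pos⇒nonZero)
open import Data.Fin using (Fin; zero; suc)
open import Data.Fin.Subset using (Subset)
open import Data.Vec using ([]; _∷_)
open import Data.Bool using (if_then_else_)

sumOver : ∀ {n} → Subset n → (Fin n → ℚ) → ℚ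
sumOver [] f = 0ℚ
sumOver (b ∷ S) f = (if b then f zero else 0ℚ) + sumOver S (λ i → f (suc i))

kk : ∀ {n} (B : ℚ) (c : Fin n → ℚ) → (∀ i → Positive (c i)) → Fin n → ℤ
kk B c cpos i = floor ((B ÷ c i) {{pos⇒nonZero (c i) {{cpos i}}}})

-- 1 / k as a rational; convention 1/k := 0 for k ≤ 0 (never used when
-- c(S) ≤ B, since then k_i ≥ 1 for every i ∈ S).
invℤ : ℤ → ℚ
invℤ (+ 0) = 0ℚ
invℤ +[1+ m ] = (+ 1) / suc m
invℤ -[1+ m ] = 0ℚ

cost : ∀ {n} → (Fin n → ℚ) → Subset n → ℚ
cost c S = sumOver S c

dens : ∀ {n} (B : ℚ) (c : Fin n → ℚ) → (∀ i → Positive (c i)) → Subset n → ℚ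
dens B c cpos S = sumOver S (λ i → invℤ (kk B c cpos i))

{-# OPTIONS --safe #-}
-- Normalise the sizes to x i = c i / B, so that Σ x i ≤ 1 and k i = ⌊1 / x i⌋.  If x ≤ 1/m, the
-- weight 1/k of an item satisfies 1/k ≤ 1/m and, since x > 1/(k + 1), also 1/k ≤ (1 + 1/m) x.
-- If no item exceeds 1/2, this linear bound alone gives 3/2.  Otherwise set aside one such item
-- (weight ≤ 1); the others have total size ≤ 1/2.  If none of them exceeds 1/3 they weigh at most
-- 4/3 · 1/2; otherwise set aside one more (size ≤ 1/2, so weight ≤ 1/2), which leaves total size
-- ≤ 1/6 and weight ≤ 7/6 · 1/6.  The totals 3/2, 5/3 and 61/36 are all at most 17/10.
module Submission where

open import Defs
open import Data.Nat using (ℕ)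
open import Data.Integer using (+_)
open import Data.Rational using (ℚ; _≤_; _/_; Positive)
open import Data.Fin using (Fin)
open import Data.Fin.Subset using (Subset)

open import Algebra.Bundles using (CommutativeMonoid)
open import Data.Bool using (true; false)
open import Data.Fin using (zero; suc)
open import Data.Integer as ℤ using (ℤ; +[1+_]; -[1+_]; +≤+)
open import Data.Integer.DivMod using (div-pos-is-/ℕ; n<s[n/ℕd]*d)
import Data.Integer.Properties as ℤ
open import Data.List using (List; []; _∷_; map)
open import Data.List.Relation.Unary.All as All using (All; []; _∷_)
import Data.Nat as ℕ
open import Data.Nat.Coprimality as Coprime using (1-coprimeTo)
import Data.Nat.Properties as ℕ
open import Data.Product using (_×_; _,_; proj₁; proj₂; ∃₂)
open import Data.Rational
  using (mkℚ; 0ℚ; 1ℚ; _+_; _*_; -_; 1/_; _÷_; _<_; *≤*; *<*; floor; NonZero; NonNegative; nonNegative)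
open import Data.Rational.Properties
open import Data.Rational.Solver using (module +-*-Solver)
open import Data.Rational.Unnormalised using (*≡*)
import Data.Rational.Unnormalised.Properties as ℚᵘ
open import Data.Sum using (_⊎_; inj₁; inj₂)
open import Data.Vec using ([]; _∷_)
open import Function using (_∘_)
open import Relation.Binary.PropositionalEquality
open import Relation.Nullary using (yes; no)
open import Relation.Unary using (Decidable; ∁)

open import Algebra.Properties.Group +-0-group using (\\-leftDividesʳ)
open import Algebra.Properties.CommutativeSemigroup
  (CommutativeMonoid.commutativeSemigroup +-0-commutativeMonoid) using (x∙yz≈y∙xz)

0≤-+ : ∀ {p q} → 0ℚ ≤ p → 0ℚ ≤ q → 0ℚ ≤ p + q
0≤-+ = +-mono-≤

0≤-* : ∀ {p q} → 0ℚ ≤ p → 0ℚ ≤ q → 0ℚ ≤ p * q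
0≤-* {p} {q} 0≤p 0≤q =
  nonNegative⁻¹ _ {{nonNeg*nonNeg⇒nonNeg p {{nonNegative 0≤p}} q {{nonNegative 0≤q}}}}

0≤1/ : ∀ q .{{_ : Positive q}} → 0ℚ ≤ (1/ q) {{pos⇒nonZero q}}
0≤1/ q = nonNegative⁻¹ (1/ q) {{pos⇒nonNeg (1/ q) {{1/pos⇒pos q}}}}
  where instance _ = pos⇒nonZero q

0≤÷ : ∀ p q .{{_ : Positive p}} .{{_ : Positive q}} → 0ℚ ≤ (p ÷ q) {{pos⇒nonZero q}}
0≤÷ p q = 0≤-* (nonNegative⁻¹ p {{pos⇒nonNeg p}}) (0≤1/ q)

≤⇒÷≤1 : ∀ {p} q .{{_ : Positive q}} → p ≤ q → (p ÷ q) {{pos⇒nonZero q}} ≤ 1ℚ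
≤⇒÷≤1 {p} q p≤q = begin
  p * 1/ q  ≤⟨ *-monoʳ-≤-nonNeg (1/ q) {{nonNegative (0≤1/ q)}} p≤q ⟩
  q * 1/ q  ≡⟨ *-inverseʳ q ⟩
  1ℚ        ∎
  where open ≤-Reasoning; instance _ = pos⇒nonZero q

÷-inverse : ∀ p q .{{_ : NonZero p}} .{{_ : NonZero q}} → (p ÷ q) * (q ÷ p) ≡ 1ℚ
÷-inverse p q = begin
  (p * 1/ q) * (q * 1/ p)  ≡⟨ solve 4 (λ p q p⁻¹ q⁻¹ → (p :* q⁻¹) :* (q :* p⁻¹)
                                                  := (p :* p⁻¹) :* (q :* q⁻¹)) refl p q (1/ p) (1/ q) ⟩
  (p * 1/ p) * (q * 1/ q)  ≡⟨ cong₂ _*_ (*-inverseʳ p) (*-inverseʳ q) ⟩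
  1ℚ                       ∎
  where open ≡-Reasoning; open +-*-Solver

+-cancelˡ-≤ : ∀ r {p q} → r + p ≤ r + q → p ≤ q
+-cancelˡ-≤ r {p} {q} r+p≤r+q =
  subst₂ _≤_ (\\-leftDividesʳ r p) (\\-leftDividesʳ r q) (+-monoʳ-≤ (- r) r+p≤r+q)

remainder-≤ : ∀ {a b d e} → a + b ≤ d + e → d ≤ a → b ≤ e
remainder-≤ {b = b} {d} a+b≤d+e d≤a = +-cancelˡ-≤ d (≤-trans (+-monoˡ-≤ b d≤a) a+b≤d+e)

p≤p+q : ∀ {p q} → 0ℚ ≤ q → p ≤ p + q
p≤p+q {p} 0≤q = ≤-trans (≤-reflexive (sym (+-identityʳ p))) (+-monoʳ-≤ p 0≤q)

p≤q+p : ∀ {p q} → 0ℚ ≤ q → p ≤ q + p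
p≤q+p {p} {q} 0≤q = ≤-trans (p≤p+q 0≤q) (≤-reflexive (+-comm p q))

fromℤ : ℤ → ℚ
fromℤ z = mkℚ z 0 (Coprime.sym (1-coprimeTo ℤ.∣ z ∣))

fromℕ : ℕ → ℚ
fromℕ n = fromℤ (+ n)

fromℕ-mono-≤ : ∀ {m n} → m ℕ.≤ n → fromℕ m ≤ fromℕ n
fromℕ-mono-≤ m≤n = *≤* (ℤ.*-monoʳ-≤-nonNeg (+ 1) (+≤+ m≤n))

fromℕ-cancel-< : ∀ {m n} → fromℕ m < fromℕ n → m ℕ.< n
fromℕ-cancel-< (*<* m<n) = ℤ.drop‿+<+ (ℤ.*-cancelʳ-<-nonNeg (+ 1) m<n)

fromℕ-suc : ∀ n → fromℕ (ℕ.suc n) ≡ 1ℚ + fromℕ n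
fromℕ-suc n = toℚᵘ-injective (ℚᵘ.≃-trans (*≡* eq) (ℚᵘ.≃-sym (toℚᵘ-homo-+ 1ℚ (fromℕ n))))
  where
  eq : + ℕ.suc n ℤ.* + 1 ≡ (+ 1 ℤ.* + 1 ℤ.+ + n ℤ.* + 1) ℤ.* + 1
  eq = cong (λ z → (+ 1 ℤ.+ z) ℤ.* + 1) (sym (ℤ.*-identityʳ (+ n)))

floor-< : ∀ q → q < fromℤ (ℤ.suc (floor q))
floor-< (mkℚ n d _) = *<* (begin-strict
  n ℤ.* + 1                                ≡⟨ ℤ.*-identityʳ n ⟩
  n                                        <⟨ n<s[n/ℕd]*d n (ℕ.suc d) ⟩
  ℤ.suc (n ℤ./ℕ ℕ.suc d) ℤ.* + ℕ.suc d     ≡⟨ cong (λ z → ℤ.suc z ℤ.* + ℕ.suc d)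
                                                   (div-pos-is-/ℕ n (ℕ.suc d)) ⟨
  ℤ.suc (n ℤ./ + ℕ.suc d) ℤ.* + ℕ.suc d    ∎)
  where open ℤ.≤-Reasoning

fromℕ*1/n≡1 : ∀ n .{{_ : ℕ.NonZero n}} → fromℕ n * (+ 1 / n) ≡ 1ℚ
fromℕ*1/n≡1 n@(ℕ.suc _) =
  trans (cong (fromℕ n *_) (normalize-coprime (1-coprimeTo n))) (*-inverseʳ (fromℕ n))

0≤1/n : ∀ n .{{_ : ℕ.NonZero n}} → 0ℚ ≤ + 1 / n
0≤1/n n = nonNegative⁻¹ _ {{normalize-nonNeg 1 n}}

≤1/n⇒fromℕ*≤1 : ∀ n .{{_ : ℕ.NonZero n}} {x} → x ≤ + 1 / n → fromℕ n * x ≤ 1ℚ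
≤1/n⇒fromℕ*≤1 n@(ℕ.suc _) x≤1/n =
  ≤-trans (*-monoˡ-≤-nonNeg (fromℕ n) x≤1/n) (≤-reflexive (fromℕ*1/n≡1 n))

fromℕ*≤1⇒≤1/n : ∀ n .{{_ : ℕ.NonZero n}} {x} → fromℕ n * x ≤ 1ℚ → x ≤ + 1 / n
fromℕ*≤1⇒≤1/n n@(ℕ.suc _) nx≤1 =
  *-cancelˡ-≤-pos (fromℕ n) (≤-trans nx≤1 (≤-reflexive (sym (fromℕ*1/n≡1 n))))

1/n-antimono : ∀ m n .{{_ : ℕ.NonZero m}} .{{_ : ℕ.NonZero n}} → m ℕ.≤ n → + 1 / n ≤ + 1 / m
1/n-antimono m n m≤n = fromℕ*≤1⇒≤1/n m (begin
  fromℕ m * (+ 1 / n)  ≤⟨ *-monoʳ-≤-nonNeg (+ 1 / n) {{normalize-nonNeg 1 n}} (fromℕ-mono-≤ m≤n) ⟩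
  fromℕ n * (+ 1 / n)  ≡⟨ fromℕ*1/n≡1 n ⟩
  1ℚ                   ∎)
  where open ≤-Reasoning

HarmonicallyBounded : ℚ → ℚ → Set
HarmonicallyBounded x w =
  ∀ k .{{_ : ℕ.NonZero k}} → x ≤ + 1 / k → w ≤ + 1 / k × w ≤ (1ℚ + + 1 / k) * x

0-harmonicallyBounded : ∀ {x} → 0ℚ ≤ x → HarmonicallyBounded x 0ℚ
0-harmonicallyBounded 0≤x k _ = 0≤1/n k , 0≤-* {1ℚ + + 1 / k} (0≤-+ {1ℚ} (≤ᵇ⇒≤ _) (0≤1/n k)) 0≤x

-- Only x > 1/(2 + j) is assumed: it already forces k ≤ 1 + j whenever x ≤ 1/k.
1/suc-harmonicallyBounded : ∀ j {x q} → 0ℚ ≤ x → 0ℚ ≤ q → x * q ≡ 1ℚ → q < fromℕ (2 ℕ.+ j) →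
                            HarmonicallyBounded x (+ 1 / ℕ.suc j)
1/suc-harmonicallyBounded j {x} {q} 0≤x 0≤q xq≡1 q<2+j k x≤1/k = w≤1/k , w≤[1+1/k]x
  where
  open ≤-Reasoning
  open +-*-Solver
  w = + 1 / ℕ.suc j
  instance
    _ : NonNegative x
    _ = nonNegative 0≤x
    _ : NonNegative q
    _ = nonNegative 0≤q
    _ : NonNegative w
    _ = normalize-nonNeg 1 (ℕ.suc j)

  k≤q : fromℕ k ≤ q
  k≤q = begin
    fromℕ k            ≡⟨ *-identityʳ (fromℕ k) ⟨
    fromℕ k * 1ℚ       ≡⟨ cong (fromℕ k *_) xq≡1 ⟨
    fromℕ k * (x * q)  ≡⟨ *-assoc (fromℕ k) x q ⟨
    fromℕ k * x * q    ≤⟨ *-monoʳ-≤-nonNeg q (≤1/n⇒fromℕ*≤1 k x≤1/k) ⟩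
    1ℚ * q             ≡⟨ *-identityˡ q ⟩
    q                  ∎

  w≤1/k : w ≤ + 1 / k
  w≤1/k = 1/n-antimono k (ℕ.suc j) (ℕ.m<1+n⇒m≤n (fromℕ-cancel-< (≤-<-trans k≤q q<2+j)))

  w≤[1+1/k]x : w ≤ (1ℚ + + 1 / k) * x
  w≤[1+1/k]x = begin
    w                                 ≡⟨ *-identityʳ w ⟨
    w * 1ℚ                            ≡⟨ cong (w *_) xq≡1 ⟨
    w * (x * q)                       ≤⟨ *-monoˡ-≤-nonNeg w (*-monoˡ-≤-nonNeg x (<⇒≤ q<2+j)) ⟩
    w * (x * fromℕ (2 ℕ.+ j))         ≡⟨ cong (λ t → w * (x * t)) (fromℕ-suc (ℕ.suc j)) ⟩
    w * (x * (1ℚ + fromℕ (ℕ.suc j)))  ≡⟨ solve 3 (λ w x J → w :* (x :* (con 1ℚ :+ J)) := (J :* w :+ w) :* x)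
                                           refl w x (fromℕ (ℕ.suc j)) ⟩
    (fromℕ (ℕ.suc j) * w + w) * x     ≡⟨ cong (λ t → (t + w) * x) (fromℕ*1/n≡1 (ℕ.suc j)) ⟩
    (1ℚ + w) * x                      ≤⟨ *-monoʳ-≤-nonNeg x (+-monoʳ-≤ 1ℚ w≤1/k) ⟩
    (1ℚ + + 1 / k) * x                ∎

invℤ-floor-harmonicallyBounded : ∀ {x q} → 0ℚ ≤ x → 0ℚ ≤ q → x * q ≡ 1ℚ →
                                 HarmonicallyBounded x (invℤ (floor q))
invℤ-floor-harmonicallyBounded {x} {q} 0≤x 0≤q xq≡1 = bound (floor q) (floor-< q)
  where
  bound : ∀ K → q < fromℤ (ℤ.suc K) → HarmonicallyBounded x (invℤ K)
  bound (+ 0)    _     = 0-harmonicallyBounded 0≤x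
  bound +[1+ j ] q<1+K = 1/suc-harmonicallyBounded j 0≤x 0≤q xq≡1 q<1+K
  bound -[1+ _ ] _     = 0-harmonicallyBounded 0≤x

sumBy : {I : Set} → (I → ℚ) → List I → ℚ
sumBy f []      = 0ℚ
sumBy f (i ∷ L) = f i + sumBy f L

module _ {I : Set} where

  sumBy-map : ∀ {J : Set} (f : J → ℚ) (g : I → J) L → sumBy f (map g L) ≡ sumBy (f ∘ g) L
  sumBy-map f g []      = refl
  sumBy-map f g (i ∷ L) = cong (_+_ (f (g i))) (sumBy-map f g L)

  sumBy-*ʳ : ∀ (f : I → ℚ) r L → sumBy (λ i → f i * r) L ≡ sumBy f L * r
  sumBy-*ʳ f r []      = sym (*-zeroˡ r)
  sumBy-*ʳ f r (i ∷ L) =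
    trans (cong (_+_ (f i * r)) (sumBy-*ʳ f r L)) (sym (*-distribʳ-+ r (f i) (sumBy f L)))

  sumBy-nonNeg : ∀ {f : I → ℚ} → (∀ i → 0ℚ ≤ f i) → ∀ L → 0ℚ ≤ sumBy f L
  sumBy-nonNeg 0≤f []      = ≤-refl
  sumBy-nonNeg 0≤f (i ∷ L) = 0≤-+ (0≤f i) (sumBy-nonNeg 0≤f L)

  sumBy-≤⇒All-≤ : ∀ {f : I → ℚ} → (∀ i → 0ℚ ≤ f i) → ∀ L {t} →
                  sumBy f L ≤ t → All (λ i → f i ≤ t) L
  sumBy-≤⇒All-≤ 0≤f []      _   = []
  sumBy-≤⇒All-≤ 0≤f (i ∷ L) Σ≤t =
    ≤-trans (p≤p+q (sumBy-nonNeg 0≤f L)) Σ≤t ∷ sumBy-≤⇒All-≤ 0≤f L (≤-trans (p≤q+p (0≤f i)) Σ≤t)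

  all-or-extract : ∀ {P : I → Set} → Decidable P → ∀ L →
                   All (∁ P) L ⊎ ∃₂ λ j L′ → P j × (∀ f → sumBy f L ≡ f j + sumBy f L′)
  all-or-extract P? [] = inj₁ []
  all-or-extract P? (i ∷ L) with P? i | all-or-extract P? L
  ... | yes Pi | _                          = inj₂ (i , L , Pi , λ f → refl)
  ... | no ¬Pi | inj₁ none                  = inj₁ (¬Pi ∷ none)
  ... | no ¬Pi | inj₂ (j , L′ , Pj , split) =
    inj₂ (j , i ∷ L′ , Pj , λ f →
      trans (cong (_+_ (f i)) (split f)) (x∙yz≈y∙xz (f i) (f j) (sumBy f L′)))

module _ {I : Set} {x w : I → ℚ} (0≤x : ∀ i → 0ℚ ≤ x i)
         (bounded : ∀ i → HarmonicallyBounded (x i) (w i)) where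

  open ≤-Reasoning

  weight-≤ : ∀ k .{{_ : ℕ.NonZero k}} {i} → x i ≤ + 1 / k → w i ≤ + 1 / k
  weight-≤ k {i} xi≤1/k = proj₁ (bounded i k xi≤1/k)

  sumBy-harmonicallyBounded : ∀ k .{{_ : ℕ.NonZero k}} L → All (λ i → x i ≤ + 1 / k) L →
                              sumBy w L ≤ (1ℚ + + 1 / k) * sumBy x L
  sumBy-harmonicallyBounded k []      []           = ≤-reflexive (sym (*-zeroʳ (1ℚ + + 1 / k)))
  sumBy-harmonicallyBounded k (i ∷ L) (xi≤ ∷ xL≤) = begin
    w i + sumBy w L                                   ≤⟨ +-mono-≤ (proj₂ (bounded i k xi≤))
                                                                  (sumBy-harmonicallyBounded k L xL≤) ⟩
    (1ℚ + + 1 / k) * x i + (1ℚ + + 1 / k) * sumBy x L ≡⟨ *-distribˡ-+ (1ℚ + + 1 / k) (x i) (sumBy x L) ⟨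
    (1ℚ + + 1 / k) * (x i + sumBy x L)                ∎

  no-large-item : ∀ L → sumBy x L ≤ 1ℚ → All (λ i → x i ≤ + 1 / 2) L → sumBy w L ≤ + 17 / 10
  no-large-item L Σx≤1 small = begin
    sumBy w L                   ≤⟨ sumBy-harmonicallyBounded 2 L small ⟩
    (1ℚ + + 1 / 2) * sumBy x L  ≤⟨ *-monoˡ-≤-nonNeg (1ℚ + + 1 / 2) Σx≤1 ⟩
    (1ℚ + + 1 / 2) * 1ℚ         ≤⟨ ≤ᵇ⇒≤ _ ⟩
    + 17 / 10                   ∎

  one-large-item : ∀ j L → x j + sumBy x L ≤ 1ℚ → + 1 / 2 ≤ x j → All (λ i → x i ≤ + 1 / 3) L →
                   w j + sumBy w L ≤ + 17 / 10
  one-large-item j L Σx≤1 large small = begin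
    w j + sumBy w L                       ≤⟨ +-mono-≤ (weight-≤ 1 xj≤1)
                                                      (sumBy-harmonicallyBounded 3 L small) ⟩
    1ℚ + (1ℚ + + 1 / 3) * sumBy x L       ≤⟨ +-monoʳ-≤ 1ℚ (*-monoˡ-≤-nonNeg (1ℚ + + 1 / 3) rest≤1/2) ⟩
    1ℚ + (1ℚ + + 1 / 3) * (+ 1 / 2)       ≤⟨ ≤ᵇ⇒≤ _ ⟩
    + 17 / 10                             ∎
    where
    xj≤1 : x j ≤ 1ℚ
    xj≤1 = ≤-trans (p≤p+q (sumBy-nonNeg 0≤x L)) Σx≤1
    rest≤1/2 : sumBy x L ≤ + 1 / 2
    rest≤1/2 = remainder-≤ {d = + 1 / 2} {e = + 1 / 2} Σx≤1 large

  large-and-medium-item : ∀ j j′ L → x j + (x j′ + sumBy x L) ≤ 1ℚ →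
                          + 1 / 2 ≤ x j → + 1 / 3 ≤ x j′ → w j + (w j′ + sumBy w L) ≤ + 17 / 10
  large-and-medium-item j j′ L Σx≤1 large medium = begin
    w j + (w j′ + sumBy w L)                       ≤⟨ +-mono-≤ (weight-≤ 1 xj≤1)
                                                        (+-mono-≤ (weight-≤ 2 xj′≤1/2)
                                                                  (sumBy-harmonicallyBounded 6 L small)) ⟩
    1ℚ + (+ 1 / 2 + (1ℚ + + 1 / 6) * sumBy x L)    ≤⟨ +-monoʳ-≤ 1ℚ (+-monoʳ-≤ (+ 1 / 2)
                                                        (*-monoˡ-≤-nonNeg (1ℚ + + 1 / 6) rest≤1/6)) ⟩
    1ℚ + (+ 1 / 2 + (1ℚ + + 1 / 6) * (+ 1 / 6))    ≤⟨ ≤ᵇ⇒≤ _ ⟩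
    + 17 / 10                                      ∎
    where
    xj≤1 : x j ≤ 1ℚ
    xj≤1 = ≤-trans (p≤p+q (0≤-+ (0≤x j′) (sumBy-nonNeg 0≤x L))) Σx≤1
    rest′≤1/2 : x j′ + sumBy x L ≤ + 1 / 2
    rest′≤1/2 = remainder-≤ {d = + 1 / 2} {e = + 1 / 2} Σx≤1 large
    xj′≤1/2 : x j′ ≤ + 1 / 2
    xj′≤1/2 = ≤-trans (p≤p+q (sumBy-nonNeg 0≤x L)) rest′≤1/2
    rest≤1/6 : sumBy x L ≤ + 1 / 6
    rest≤1/6 = remainder-≤ {d = + 1 / 3} {e = + 1 / 6} rest′≤1/2 medium
    small : All (λ i → x i ≤ + 1 / 6) L
    small = sumBy-≤⇒All-≤ 0≤x L rest≤1/6

  with-large-item : ∀ j L → x j + sumBy x L ≤ 1ℚ → + 1 / 2 ≤ x j → w j + sumBy w L ≤ + 17 / 10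
  with-large-item j L Σx≤1 large with all-or-extract (λ i → + 1 / 3 <? x i) L
  ... | inj₁ noMedium = one-large-item j L Σx≤1 large (All.map ≮⇒≥ noMedium)
  ... | inj₂ (j′ , L′ , medium , split) = begin
    w j + sumBy w L           ≡⟨ cong (_+_ (w j)) (split w) ⟩
    w j + (w j′ + sumBy w L′) ≤⟨ large-and-medium-item j j′ L′
                                    (subst (λ s → x j + s ≤ 1ℚ) (split x) Σx≤1) large (<⇒≤ medium) ⟩
    + 17 / 10                 ∎

  harmonic-sum-≤ : ∀ L → sumBy x L ≤ 1ℚ → sumBy w L ≤ + 17 / 10
  harmonic-sum-≤ L Σx≤1 with all-or-extract (λ i → + 1 / 2 <? x i) L
  ... | inj₁ noLarge = no-large-item L Σx≤1 (All.map ≮⇒≥ noLarge)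
  ... | inj₂ (j , L′ , large , split) = begin
    sumBy w L        ≡⟨ split w ⟩
    w j + sumBy w L′ ≤⟨ with-large-item j L′ (subst (_≤ 1ℚ) (split x) Σx≤1) (<⇒≤ large) ⟩
    + 17 / 10        ∎

elements : ∀ {n} → Subset n → List (Fin n)
elements []          = []
elements (true ∷ S)  = zero ∷ map suc (elements S)
elements (false ∷ S) = map suc (elements S)

sumOver-elements : ∀ {n} (S : Subset n) f → sumOver S f ≡ sumBy f (elements S)
sumOver-suc-elements : ∀ {n} (S : Subset n) (f : Fin (ℕ.suc n) → ℚ) →
                       sumOver S (f ∘ suc) ≡ sumBy f (map suc (elements S))

sumOver-elements []          f = refl
sumOver-elements (true ∷ S)  f = cong (_+_ (f zero)) (sumOver-suc-elements S f)
sumOver-elements (false ∷ S) f = trans (+-identityˡ _) (sumOver-suc-elements S f)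

sumOver-suc-elements S f = trans (sumOver-elements S (f ∘ suc)) (sym (sumBy-map f suc (elements S)))

lemma5 : (n : ℕ) (B : ℚ) → Positive B → (c : Fin n → ℚ) → (cpos : ∀ i → Positive (c i)) →
         (S : Subset n) → cost c S ≤ B → dens B c cpos S ≤ (+ 17) / 10
lemma5 n B Bpos c cpos S cost≤B = begin
  dens B c cpos S       ≡⟨ sumOver-elements S w ⟩
  sumBy w (elements S)  ≤⟨ harmonic-sum-≤ 0≤x bounded (elements S) Σx≤1 ⟩
  + 17 / 10             ∎
  where
  open ≤-Reasoning
  instance
    _ : Positive B
    _ = Bpos
    _ : NonZero B
    _ = pos⇒nonZero B
  x w : Fin n → ℚ
  x i = c i ÷ B
  w i = invℤ (kk B c cpos i)
  0≤x : ∀ i → 0ℚ ≤ x i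
  0≤x i = 0≤÷ (c i) B {{cpos i}}
  bounded : ∀ i → HarmonicallyBounded (x i) (w i)
  bounded i = invℤ-floor-harmonicallyBounded (0≤x i) (0≤÷ B (c i) {{Bpos}} {{cpos i}})
                                             (÷-inverse (c i) B {{pos⇒nonZero (c i) {{cpos i}}}})
  Σx≤1 : sumBy x (elements S) ≤ 1ℚ
  Σx≤1 = begin
    sumBy x (elements S)           ≡⟨ sumBy-*ʳ c (1/ B) (elements S) ⟩
    sumBy c (elements S) * 1/ B    ≡⟨ cong (_* 1/ B) (sumOver-elements S c) ⟨
    cost c S * 1/ B                ≤⟨ ≤⇒÷≤1 B cost≤B ⟩
    1ℚ                             ∎
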